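{- Let $k\geq 2$ and let $M$ be a simple binary matroid with an exact vertical $k$-separation $(X,Y)$ such that $\mathrm{cl}_M(X)\cap\mathrm{cl}_M(Y)=\emptyset$. Then $M$ has an induced minor isomorphic to $M(C_4)$.
   Context: A vertical $k$-separation of $M$ is a partition $(X,Y)$ of $E(M)$ with $r(X)+r(Y)-r(M)\leq k-1$ and $\min\{r(X),r(Y)\}\geq k$; it is exact if $r(X)+r(Y)-r(M)=k-1$. All matroids are finite and simple; every contraction is immediately followed by simplification. An induced minor of $M$ is any matroid obtained from $M$ by a sequence of contractions (followed by simplification) and restrictions to flats. $M(C_4)\cong U_{3,4}$. -}

module Defs where

open import Data.Nat using (ℕ; zero; suc; _+_; _∸_; _≤_; _⊓_)
open import Data.Bool using (Bool; true; false; _∧_; _∨_; _xor_; if_then_else_)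
open import Data.Fin using (Fin; zero; suc; _≟_)
open import Data.Fin.Subset
  using (Subset; _∈_; _∉_; _⊆_; ⁅_⁆; _∪_; _∩_; ∣_∣; Nonempty)
  renaming (⊥ to ∅; ⊤ to Full)
open import Data.Vec using (Vec; []; _∷_; tabulate; lookup; replicate; zipWith)
open import Data.Product using (Σ; Σ-syntax; ∃; _×_; _,_)
open import Relation.Nullary using (¬_)
open import Relation.Nullary.Decidable using (⌊_⌋)
open import Relation.Binary.PropositionalEquality using (_≡_; _≢_)
open import Function using (_∘_)
open import Function.Definitions using (Injective)

record Matroid (n : ℕ) : Set where
  field
    r        : Subset n → ℕ
    r-bound  : ∀ X → r X ≤ ∣ X ∣
    r-mono   : ∀ X Y → X ⊆ Y → r X ≤ r Y
    r-submod : ∀ X Y → r (X ∪ Y) + r (X ∩ Y) ≤ r X + r Y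

open Matroid public

cl : ∀ {n} → Matroid n → Subset n → Subset n
cl M X = tabulate (λ e → ⌊ r M (X ∪ ⁅ e ⁆) Data.Nat.≟ r M X ⌋)

IsFlat : ∀ {n} → Matroid n → Subset n → Set
IsFlat M F = cl M F ≡ F

Simple : ∀ {n} → Matroid n → Set
Simple {n} M = (∀ (e : Fin n) → r M ⁅ e ⁆ ≡ 1)
             × (∀ (e f : Fin n) → e ≢ f → r M (⁅ e ⁆ ∪ ⁅ f ⁆) ≡ 2)

sumOver : ∀ {n d} → (Fin n → Vec Bool d) → Subset n → Vec Bool d
sumOver {zero}  {d} φ []      = replicate d false
sumOver {suc n} {d} φ (b ∷ J) =
  zipWith _xor_ (if b then φ zero else replicate d false) (sumOver (φ ∘ suc) J)

GF2Indep : ∀ {n d} → (Fin n → Vec Bool d) → Subset n → Set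
GF2Indep {n} {d} φ I =
  ∀ (J : Subset n) → J ⊆ I → Nonempty J → sumOver φ J ≢ replicate d false

IsGF2RankOf : ∀ {n d} → (Fin n → Vec Bool d) → Subset n → ℕ → Set
IsGF2RankOf {n} φ X k =
  (Σ[ I ∈ Subset n ] (I ⊆ X × GF2Indep φ I × ∣ I ∣ ≡ k))
  × (∀ (I : Subset n) → I ⊆ X → GF2Indep φ I → ∣ I ∣ ≤ k)

Binary : ∀ {n} → Matroid n → Set
Binary {n} M = Σ[ d ∈ ℕ ] Σ[ φ ∈ (Fin n → Vec Bool d) ]
  (∀ (X : Subset n) → IsGF2RankOf φ X (r M X))

IsPartition : ∀ {n} → Subset n → Subset n → Set
IsPartition X Y = (X ∪ Y ≡ Full) × (X ∩ Y ≡ ∅)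

VerticalSep : ∀ {n} → Matroid n → ℕ → Subset n → Subset n → Set
VerticalSep M k X Y =
  IsPartition X Y × (r M X + r M Y ≤ r M Full + (k ∸ 1)) × (k ≤ r M X) × (k ≤ r M Y)

ExactVerticalSep : ∀ {n} → Matroid n → ℕ → Subset n → Subset n → Set
ExactVerticalSep M k X Y =
  VerticalSep M k X Y × (r M X + r M Y ≡ r M Full + (k ∸ 1))

anyFin : ∀ {m} → (Fin m → Bool) → Bool
anyFin {zero}  f = false
anyFin {suc m} f = f zero ∨ anyFin (f ∘ suc)

img : ∀ {m n} → (Fin m → Fin n) → Subset m → Subset n
img ι X = tabulate (λ j → anyFin (λ i → lookup X i ∧ ⌊ ι i ≟ j ⌋))

RestrictFlat : ∀ {n m} → Matroid n → Matroid m → Set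
RestrictFlat {n} {m} M N = Σ[ ι ∈ (Fin m → Fin n) ]
  (Injective _≡_ _≡_ ι × IsFlat M (img ι Full)
   × (∀ (X : Subset m) → r N X ≡ r M (img ι X)))

-- e and f are parallel in M/C (both assumed non-loops of M/C)
ParallelIn/ : ∀ {n} → Matroid n → Subset n → Fin n → Fin n → Set
ParallelIn/ M C e f = r M (C ∪ (⁅ e ⁆ ∪ ⁅ f ⁆)) ≡ suc (r M C)

-- N is isomorphic to si(M/C): ι picks exactly one representative of each
-- parallel class of non-loops of M/C, and the rank of N is that of M/C.
ContractSimp : ∀ {n m} → Matroid n → Matroid m → Set
ContractSimp {n} {m} M N = Σ[ C ∈ Subset n ] Σ[ ι ∈ (Fin m → Fin n) ]
  ( (∀ (i : Fin m) → ι i ∉ cl M C)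
  × (∀ (i j : Fin m) → i ≢ j → ¬ ParallelIn/ M C (ι i) (ι j))
  × (∀ (e : Fin n) → e ∉ cl M C → Σ[ i ∈ Fin m ] ParallelIn/ M C e (ι i))
  × (∀ (X : Subset m) → r N X + r M C ≡ r M (img ι X ∪ C)))

-- induced minor: sequence of contractions (each followed by simplification)
-- and restrictions to flats (the latter also covering isomorphism)
data InducedMinor {n : ℕ} (M : Matroid n) : {m : ℕ} → Matroid m → Set where
  done  : InducedMinor M M
  contr : ∀ {k m} {K : Matroid k} {N : Matroid m} →
          ContractSimp M K → InducedMinor K N → InducedMinor M N
  restr : ∀ {k m} {K : Matroid k} {N : Matroid m} →
          RestrictFlat M K → InducedMinor K N → InducedMinor M N

-- N is (on ground set Fin 4) the uniform matroid U_{3,4} ≅ M(C_4)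
IsU34 : Matroid 4 → Set
IsU34 N = ∀ (X : Subset 4) → r N X ≡ ∣ X ∣ ⊓ 3

HasInducedMC4 : ∀ {n} → Matroid n → Set
HasInducedMC4 M = Σ[ N ∈ Matroid 4 ] (IsU34 N × InducedMinor M N)

-- Represent M over GF(2) by φ; circuits are then the minimal nonempty sets whose vectors sum
-- to zero. Bases of X and of Y together have r(X) + r(Y) = r(M) + k - 1 > r(M) elements, so they
-- contain a circuit, and it meets both X and Y. Take a smallest circuit D meeting both sides.
-- D is a flat: a point x ∈ cl(D) - D is the sum of some S ⊆ D, hence also of D - S; simplicity
-- gives |S|, |D - S| ≥ 2, and x together with whichever part contains a point of D on the other
-- side of x contains a strictly smaller circuit meeting both sides. As cl(X) ∩ cl(Y) = ∅, a point
-- a with D ∩ X = {a} would lie in cl(D - a) ⊆ cl(Y); so D has two points in X and two in Y.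
-- Restricted to the flat D the matroid is U(|D|-1, |D|), and contracting all of D but those four
-- points leaves U(3, 4).

module Submission where

open import Defs
open import Data.Nat using (ℕ; zero; suc; _+_; _∸_; _≤_; _<_; _⊓_; z≤n; s≤s; _≤?_)
import Data.Nat.Properties as ℕ
import Data.Nat.Induction as ℕ
open import Data.Bool using (Bool; true; false; T; _∧_; _xor_; if_then_else_)
open import Data.Bool.Properties
  using (xor-identityˡ; xor-identityʳ; xor-assoc; xor-comm; xor-same; T-≡; T-∧; T-∨)
  renaming (_≟_ to _≟ᵇ_)
open import Data.Fin using (Fin; zero; suc; _≟_)
open import Data.Fin.Patterns using (0F; 1F; 2F; 3F)
open import Data.Fin.Properties using (any?; suc-injective)
open import Data.Fin.Subset
  using (Subset; _∈_; _∉_; _⊆_; _⊂_; ⁅_⁆; _∪_; _∩_; _─_; _-_; ∁; ∣_∣; Nonempty; inside; outside)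
  renaming (⊥ to ∅; ⊤ to Full)
open import Data.Fin.Subset.Properties
  using (_∈?_; _⊆?_; _⊂?_; nonempty?; anySubset?; Empty-unique; ∈⊤; ∉⊥; x∈⁅x⁆; x∈⁅y⁆⇒x≡y
        ; ⊆-refl; ⊆-trans; ⊆-antisym; ⊆⊤; drop-∷-⊆; p⊂q⇒p⊆q; p⊆p∪q; q⊆p∪q; x∈p∪q⁻; x∈p∩q⁺; x∈p∩q⁻
        ; ∪-comm; ∪-idem; ∪-identityˡ; p─q⊆p; x∈p∧x∉q⇒x∈p─q; x∈p∧x≢y⇒x∈p-y; x∈p⇒x∉∁p; x∉∁p⇒x∈p
        ; p⊆q⇒∣p∣≤∣q∣; p⊂q⇒∣p∣<∣q∣; x∈p⇒∣p-x∣<∣p∣; ∣p∣≤n; ∣⊤∣≡n; ∣⊥∣≡0; ∣⁅x⁆∣≡1; ∣∁p∣≡n∸∣p∣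
        ; ∣p∩q∣≤∣p∣; ∣p∩q∣≤∣q∣)
open import Data.Fin.Subset.Induction using (⊂-wellFounded)
open import Data.Vec using (Vec; []; _∷_; here; there; replicate; zipWith; tabulate; lookup)
open import Data.Vec.Properties
  using (zipWith-identityˡ; zipWith-identityʳ; zipWith-assoc; zipWith-comm; ≡-dec
        ; lookup∘tabulate; []=⇒lookup; lookup⇒[]=)
open import Data.Product using (∃; ∃₂; _×_; _,_; proj₁; proj₂)
open import Data.Sum using (_⊎_; inj₁; inj₂; swap)
open import Data.Empty using (⊥-elim)
open import Function using (_∘_; Injective; Equivalence)
open import Induction.WellFounded using (module All)
open import Level using (0ℓ)
open import Relation.Nullary using (¬_; Dec; yes; no)
open import Relation.Nullary.Decidable using (⌊_⌋; _×-dec_; ¬?; toWitness; fromWitness)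
import Relation.Binary.Construct.On as On
open import Relation.Binary.PropositionalEquality
  using (_≡_; _≢_; refl; sym; trans; cong; cong₂; subst; module ≡-Reasoning)

private variable
  m n d : ℕ

infixl 6 _⊕_

_⊕_ : Vec Bool d → Vec Bool d → Vec Bool d
_⊕_ = zipWith _xor_

0ᵛ : Vec Bool d
0ᵛ = replicate _ false

⊕-identityˡ : (v : Vec Bool d) → 0ᵛ ⊕ v ≡ v
⊕-identityˡ = zipWith-identityˡ xor-identityˡ

⊕-identityʳ : (v : Vec Bool d) → v ⊕ 0ᵛ ≡ v
⊕-identityʳ = zipWith-identityʳ xor-identityʳ

⊕-assoc : (u v w : Vec Bool d) → (u ⊕ v) ⊕ w ≡ u ⊕ (v ⊕ w)
⊕-assoc = zipWith-assoc xor-assoc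

⊕-comm : (u v : Vec Bool d) → u ⊕ v ≡ v ⊕ u
⊕-comm = zipWith-comm xor-comm

⊕-self : (v : Vec Bool d) → v ⊕ v ≡ 0ᵛ
⊕-self []      = refl
⊕-self (x ∷ v) = cong₂ _∷_ (xor-same x) (⊕-self v)

⊕-interchange : (a b c e : Vec Bool d) → (a ⊕ b) ⊕ (c ⊕ e) ≡ (a ⊕ c) ⊕ (b ⊕ e)
⊕-interchange a b c e = begin
  (a ⊕ b) ⊕ (c ⊕ e)  ≡⟨ ⊕-assoc a b (c ⊕ e) ⟩
  a ⊕ (b ⊕ (c ⊕ e))  ≡⟨ cong (a ⊕_) (sym (⊕-assoc b c e)) ⟩
  a ⊕ ((b ⊕ c) ⊕ e)  ≡⟨ cong (λ t → a ⊕ (t ⊕ e)) (⊕-comm b c) ⟩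
  a ⊕ ((c ⊕ b) ⊕ e)  ≡⟨ cong (a ⊕_) (⊕-assoc c b e) ⟩
  a ⊕ (c ⊕ (b ⊕ e))  ≡⟨ sym (⊕-assoc a c (b ⊕ e)) ⟩
  (a ⊕ c) ⊕ (b ⊕ e)  ∎
  where open ≡-Reasoning

-- Finite sets; on Subset n = Vec Bool n, _⊕_ is symmetric difference

Disjoint : Subset n → Subset n → Set
Disjoint p q = ∀ {x} → x ∈ p → x ∉ q

∩≡∅⇒Disjoint : {p q : Subset n} → p ∩ q ≡ ∅ → Disjoint p q
∩≡∅⇒Disjoint p∩q≡∅ x∈p x∈q = ∉⊥ (subst (_ ∈_) p∩q≡∅ (x∈p∩q⁺ (x∈p , x∈q)))

∪≡⊕ : (p q : Subset n) → Disjoint p q → p ∪ q ≡ p ⊕ q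
∪≡⊕ []            []            _   = refl
∪≡⊕ (inside ∷ p)  (inside ∷ q)  p#q = ⊥-elim (p#q here here)
∪≡⊕ (inside ∷ p)  (outside ∷ q) p#q = cong (inside ∷_) (∪≡⊕ p q λ x∈p x∈q → p#q (there x∈p) (there x∈q))
∪≡⊕ (outside ∷ p) (s ∷ q)       p#q = cong (s ∷_) (∪≡⊕ p q λ x∈p x∈q → p#q (there x∈p) (there x∈q))

─≡⊕ : (p q : Subset n) → q ⊆ p → p ─ q ≡ p ⊕ q
─≡⊕ []            []            _   = refl
─≡⊕ (inside ∷ p)  (inside ∷ q)  q⊆p = cong (outside ∷_) (─≡⊕ p q (drop-∷-⊆ q⊆p))
─≡⊕ (inside ∷ p)  (outside ∷ q) q⊆p = cong (inside ∷_) (─≡⊕ p q (drop-∷-⊆ q⊆p))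
─≡⊕ (outside ∷ p) (outside ∷ q) q⊆p = cong (outside ∷_) (─≡⊕ p q (drop-∷-⊆ q⊆p))
─≡⊕ (outside ∷ p) (inside ∷ q)  q⊆p with () ← q⊆p here

x∈p─q⇒x∉q : {x : Fin n} {p q : Subset n} → x ∈ p ─ q → x ∉ q
x∈p─q⇒x∉q {x = zero}  {inside ∷ _}  {outside ∷ _} here       = λ ()
x∈p─q⇒x∉q {x = zero}  {_ ∷ _}       {inside ∷ _}  ()
x∈p─q⇒x∉q {x = zero}  {outside ∷ _} {outside ∷ _} ()
x∈p─q⇒x∉q {x = suc _} {_ ∷ p}       {_ ∷ q}       (there x∈) (there x∈q) = x∈p─q⇒x∉q {p = p} x∈ x∈q

x∉p-x : (p : Subset n) (x : Fin n) → x ∉ p - x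
x∉p-x p x x∈ = x∈p─q⇒x∉q {p = p} x∈ (x∈⁅x⁆ x)

y∈p-x⇒y≢x : {p : Subset n} {x y : Fin n} → y ∈ p - x → y ≢ x
y∈p-x⇒y≢x {p = p} {x} y∈ refl = x∉p-x p x y∈

p⊆[p-x]∪⁅x⁆ : (p : Subset n) (x : Fin n) → p ⊆ (p - x) ∪ ⁅ x ⁆
p⊆[p-x]∪⁅x⁆ p x {y} y∈p with y ≟ x
... | yes refl = q⊆p∪q (p - x) ⁅ x ⁆ (x∈⁅x⁆ x)
... | no y≢x   = p⊆p∪q ⁅ x ⁆ (x∈p∧x≢y⇒x∈p-y y∈p y≢x)

x∈p⇒p∪⁅x⁆≡p : {p : Subset n} {x : Fin n} → x ∈ p → p ∪ ⁅ x ⁆ ≡ p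
x∈p⇒p∪⁅x⁆≡p {p = p} {x} x∈p = ⊆-antisym absorb (p⊆p∪q ⁅ x ⁆)
  where
  absorb : p ∪ ⁅ x ⁆ ⊆ p
  absorb y∈ with x∈p∪q⁻ p ⁅ x ⁆ y∈
  ... | inj₁ y∈p = y∈p
  ... | inj₂ y∈x rewrite x∈⁅y⁆⇒x≡y x y∈x = x∈p

∪-monoˡ-⊆ : (q : Subset n) {p p′ : Subset n} → p ⊆ p′ → p ∪ q ⊆ p′ ∪ q
∪-monoˡ-⊆ q {p} {p′} p⊆p′ x∈ with x∈p∪q⁻ p q x∈
... | inj₁ x∈p = p⊆p∪q q (p⊆p′ x∈p)
... | inj₂ x∈q = q⊆p∪q p′ q x∈q

∪-monoʳ-⊆ : (p : Subset n) {q q′ : Subset n} → q ⊆ q′ → p ∪ q ⊆ p ∪ q′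
∪-monoʳ-⊆ p {q} {q′} q⊆q′ x∈ with x∈p∪q⁻ p q x∈
... | inj₁ x∈p = p⊆p∪q q′ x∈p
... | inj₂ x∈q = q⊆p∪q p q′ (q⊆q′ x∈q)

p⊈q⇒∃ : {p q : Subset n} → ¬ (p ⊆ q) → ∃ λ x → x ∈ p × x ∉ q
p⊈q⇒∃ {p = p} {q} p⊈q with any? (λ x → (x ∈? p) ×-dec ¬? (x ∈? q))
... | yes witness = witness
... | no  none    = ⊥-elim (p⊈q p⊆q)
  where
  p⊆q : p ⊆ q
  p⊆q {x} x∈p with x ∈? q
  ... | yes x∈q = x∈q
  ... | no  x∉q = ⊥-elim (none (x , x∈p , x∉q))

TwoElements : Subset n → Set
TwoElements A = ∃₂ λ s t → s ≢ t × s ∈ A × t ∈ A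

twoElements? : (A : Subset n) → Dec (TwoElements A)
twoElements? A = any? λ s → any? λ t → ¬? (s ≟ t) ×-dec (s ∈? A) ×-dec (t ∈? A)

TwoElements-mono : {A B : Subset n} → A ⊆ B → TwoElements A → TwoElements B
TwoElements-mono A⊆B (s , t , s≢t , s∈A , t∈A) = s , t , s≢t , A⊆B s∈A , A⊆B t∈A

Minimal : (Subset n → Set) → Subset n → Set
Minimal P W = P W × (∀ {J} → J ⊆ W → P J → W ⊆ J)

∃-minimal : {P : Subset n → Set} → (∀ Z → Dec (P Z)) →
            ∀ {Z} → P Z → ∃ λ W → W ⊆ Z × Minimal P W
∃-minimal {n} {P} P? {Z} = All.wfRec ⊂-wellFounded 0ℓ Goal step Z
  where
  Goal : Subset n → Set
  Goal Z = P Z → ∃ λ W → W ⊆ Z × Minimal P W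
  step : ∀ Z → (∀ {J} → J ⊂ Z → Goal J) → Goal Z
  step Z ih PZ with anySubset? (λ J → (J ⊂? Z) ×-dec P? J)
  ... | yes (J , J⊂Z , PJ) = let (W , W⊆J , minW) = ih J⊂Z PJ in W , ⊆-trans W⊆J (p⊂q⇒p⊆q J⊂Z) , minW
  ... | no  ¬smaller       = Z , ⊆-refl , PZ , least
    where
    least : ∀ {J} → J ⊆ Z → P J → Z ⊆ J
    least {J} J⊆Z PJ {x} x∈Z with x ∈? J
    ... | yes x∈J = x∈J
    ... | no  x∉J = ⊥-elim (¬smaller (J , (J⊆Z , x , x∈Z , x∉J) , PJ))

∣p∪q∣+∣p∩q∣≡∣p∣+∣q∣ : (p q : Subset n) → ∣ p ∪ q ∣ + ∣ p ∩ q ∣ ≡ ∣ p ∣ + ∣ q ∣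
∣p∪q∣+∣p∩q∣≡∣p∣+∣q∣ []            []            = refl
∣p∪q∣+∣p∩q∣≡∣p∣+∣q∣ (inside ∷ p)  (inside ∷ q)  =
  cong suc (trans (ℕ.+-suc _ _) (trans (cong suc (∣p∪q∣+∣p∩q∣≡∣p∣+∣q∣ p q)) (sym (ℕ.+-suc _ _))))
∣p∪q∣+∣p∩q∣≡∣p∣+∣q∣ (inside ∷ p)  (outside ∷ q) = cong suc (∣p∪q∣+∣p∩q∣≡∣p∣+∣q∣ p q)
∣p∪q∣+∣p∩q∣≡∣p∣+∣q∣ (outside ∷ p) (inside ∷ q)  =
  trans (cong suc (∣p∪q∣+∣p∩q∣≡∣p∣+∣q∣ p q)) (sym (ℕ.+-suc _ _))
∣p∪q∣+∣p∩q∣≡∣p∣+∣q∣ (outside ∷ p) (outside ∷ q) = ∣p∪q∣+∣p∩q∣≡∣p∣+∣q∣ p q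

∣p∪q∣≤∣p∣+∣q∣ : (p q : Subset n) → ∣ p ∪ q ∣ ≤ ∣ p ∣ + ∣ q ∣
∣p∪q∣≤∣p∣+∣q∣ p q = ℕ.≤-trans (ℕ.m≤m+n _ _) (ℕ.≤-reflexive (∣p∪q∣+∣p∩q∣≡∣p∣+∣q∣ p q))

∣p∪q∣≡∣p∣+∣q∣ : (p q : Subset n) → Disjoint p q → ∣ p ∪ q ∣ ≡ ∣ p ∣ + ∣ q ∣
∣p∪q∣≡∣p∣+∣q∣ {n} p q p#q = begin
  ∣ p ∪ q ∣                ≡⟨ sym (ℕ.+-identityʳ _) ⟩
  ∣ p ∪ q ∣ + 0            ≡⟨ cong (∣ p ∪ q ∣ +_) (sym (∣⊥∣≡0 n)) ⟩
  ∣ p ∪ q ∣ + ∣ ∅ {n} ∣    ≡⟨ cong (λ s → ∣ p ∪ q ∣ + ∣ s ∣) (sym p∩q≡∅) ⟩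
  ∣ p ∪ q ∣ + ∣ p ∩ q ∣    ≡⟨ ∣p∪q∣+∣p∩q∣≡∣p∣+∣q∣ p q ⟩
  ∣ p ∣ + ∣ q ∣            ∎
  where
  open ≡-Reasoning
  p∩q≡∅ : p ∩ q ≡ ∅
  p∩q≡∅ = Empty-unique λ (x , x∈p∩q) → let (x∈p , x∈q) = x∈p∩q⁻ p q x∈p∩q in p#q x∈p x∈q

∣⁅x⁆∪⁅y⁆∣≡2 : {x y : Fin n} → x ≢ y → ∣ ⁅ x ⁆ ∪ ⁅ y ⁆ ∣ ≡ 2
∣⁅x⁆∪⁅y⁆∣≡2 {x = x} {y} x≢y =
  trans (∣p∪q∣≡∣p∣+∣q∣ ⁅ x ⁆ ⁅ y ⁆ λ z∈x z∈y → x≢y (trans (sym (x∈⁅y⁆⇒x≡y x z∈x)) (x∈⁅y⁆⇒x≡y y z∈y)))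
        (cong₂ _+_ (∣⁅x⁆∣≡1 x) (∣⁅x⁆∣≡1 y))

∣p∣≤1+∣p-x∣ : (p : Subset n) (x : Fin n) → ∣ p ∣ ≤ suc ∣ p - x ∣
∣p∣≤1+∣p-x∣ p x = begin
  ∣ p ∣                  ≤⟨ p⊆q⇒∣p∣≤∣q∣ (p⊆[p-x]∪⁅x⁆ p x) ⟩
  ∣ (p - x) ∪ ⁅ x ⁆ ∣    ≤⟨ ∣p∪q∣≤∣p∣+∣q∣ (p - x) ⁅ x ⁆ ⟩
  ∣ p - x ∣ + ∣ ⁅ x ⁆ ∣  ≡⟨ cong (∣ p - x ∣ +_) (∣⁅x⁆∣≡1 x) ⟩
  ∣ p - x ∣ + 1          ≡⟨ ℕ.+-comm _ 1 ⟩
  suc ∣ p - x ∣          ∎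
  where open ℕ.≤-Reasoning

x∈p⇒1+∣p-x∣≡∣p∣ : {p : Subset n} {x : Fin n} → x ∈ p → suc ∣ p - x ∣ ≡ ∣ p ∣
x∈p⇒1+∣p-x∣≡∣p∣ {p = p} {x} x∈p = ℕ.≤-antisym (x∈p⇒∣p-x∣<∣p∣ x∈p) (∣p∣≤1+∣p-x∣ p x)

p⊆q∧∣q∣≤∣p∣⇒q⊆p : {p q : Subset n} → p ⊆ q → ∣ q ∣ ≤ ∣ p ∣ → q ⊆ p
p⊆q∧∣q∣≤∣p∣⇒q⊆p {p = p} {q} p⊆q ∣q∣≤∣p∣ {x} x∈q with x ∈? p
... | yes x∈p = x∈p
... | no  x∉p = ⊥-elim (ℕ.<⇒≱ (p⊂q⇒∣p∣<∣q∣ (p⊆q , x , x∈q , x∉p)) ∣q∣≤∣p∣)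

sumOver-⊕ : (φ : Fin n → Vec Bool d) (p q : Subset n) →
            sumOver φ (p ⊕ q) ≡ sumOver φ p ⊕ sumOver φ q
sumOver-⊕ φ []      []      = sym (⊕-identityˡ 0ᵛ)
sumOver-⊕ φ (a ∷ p) (b ∷ q) = begin
  pick (a xor b) ⊕ sumOver (φ ∘ suc) (p ⊕ q)
    ≡⟨ cong₂ _⊕_ (pick-xor a b) (sumOver-⊕ (φ ∘ suc) p q) ⟩
  (pick a ⊕ pick b) ⊕ (sumOver (φ ∘ suc) p ⊕ sumOver (φ ∘ suc) q)
    ≡⟨ ⊕-interchange (pick a) (pick b) _ _ ⟩
  (pick a ⊕ sumOver (φ ∘ suc) p) ⊕ (pick b ⊕ sumOver (φ ∘ suc) q)  ∎
  where
  open ≡-Reasoning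
  pick : Bool → Vec Bool _
  pick b = if b then φ zero else 0ᵛ
  pick-xor : ∀ a b → pick (a xor b) ≡ pick a ⊕ pick b
  pick-xor false false = sym (⊕-identityˡ 0ᵛ)
  pick-xor false true  = sym (⊕-identityˡ (φ zero))
  pick-xor true  false = sym (⊕-identityʳ (φ zero))
  pick-xor true  true  = sym (⊕-self (φ zero))

sumOver-∅ : (φ : Fin n → Vec Bool d) → sumOver φ ∅ ≡ 0ᵛ
sumOver-∅ {zero}  φ = refl
sumOver-∅ {suc n} φ = trans (⊕-identityˡ _) (sumOver-∅ (φ ∘ suc))

sumOver-⁅⁆ : (φ : Fin n → Vec Bool d) (x : Fin n) → sumOver φ ⁅ x ⁆ ≡ φ x
sumOver-⁅⁆ φ zero    = trans (cong (φ zero ⊕_) (sumOver-∅ (φ ∘ suc))) (⊕-identityʳ (φ zero))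
sumOver-⁅⁆ φ (suc x) = trans (⊕-identityˡ _) (sumOver-⁅⁆ (φ ∘ suc) x)

sumOver-∪ : (φ : Fin n → Vec Bool d) {p q : Subset n} → Disjoint p q →
            sumOver φ (p ∪ q) ≡ sumOver φ p ⊕ sumOver φ q
sumOver-∪ φ {p} {q} p#q = trans (cong (sumOver φ) (∪≡⊕ p q p#q)) (sumOver-⊕ φ p q)

sumOver-─ : (φ : Fin n → Vec Bool d) {p q : Subset n} → q ⊆ p →
            sumOver φ (p ─ q) ≡ sumOver φ p ⊕ sumOver φ q
sumOver-─ φ {p} {q} q⊆p = trans (cong (sumOver φ) (─≡⊕ p q q⊆p)) (sumOver-⊕ φ p q)

⊓-submodular : ∀ t {p q x y} → p + q ≤ x + y → q ≤ x → q ≤ y → p ⊓ t + q ⊓ t ≤ x ⊓ t + y ⊓ t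
⊓-submodular t {p} {q} {x} {y} p+q≤x+y q≤x q≤y with ℕ.⊓-sel x t | ℕ.⊓-sel y t
... | inj₁ x⊓t≡x | inj₁ y⊓t≡y rewrite x⊓t≡x | y⊓t≡y =
  ℕ.≤-trans (ℕ.+-mono-≤ (ℕ.m⊓n≤m p t) (ℕ.m⊓n≤m q t)) p+q≤x+y
... | inj₁ x⊓t≡x | inj₂ y⊓t≡t rewrite x⊓t≡x | y⊓t≡t =
  ℕ.≤-trans (ℕ.≤-reflexive (ℕ.+-comm (p ⊓ t) (q ⊓ t)))
            (ℕ.+-mono-≤ (ℕ.≤-trans (ℕ.m⊓n≤m q t) q≤x) (ℕ.m⊓n≤n p t))
... | inj₂ x⊓t≡t | inj₁ y⊓t≡y rewrite x⊓t≡t | y⊓t≡y =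
  ℕ.+-mono-≤ (ℕ.m⊓n≤n p t) (ℕ.≤-trans (ℕ.m⊓n≤m q t) q≤y)
... | inj₂ x⊓t≡t | inj₂ y⊓t≡t rewrite x⊓t≡t | y⊓t≡t =
  ℕ.+-mono-≤ (ℕ.m⊓n≤n p t) (ℕ.m⊓n≤n q t)

uniform : ℕ → (n : ℕ) → Matroid n
uniform t n = record
  { r        = λ Z → ∣ Z ∣ ⊓ t
  ; r-bound  = λ Z → ℕ.m⊓n≤m ∣ Z ∣ t
  ; r-mono   = λ A B A⊆B → ℕ.⊓-monoˡ-≤ t (p⊆q⇒∣p∣≤∣q∣ A⊆B)
  ; r-submod = λ A B → ⊓-submodular t (ℕ.≤-reflexive (∣p∪q∣+∣p∩q∣≡∣p∣+∣q∣ A B))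
                                      (∣p∩q∣≤∣p∣ A B) (∣p∩q∣≤∣q∣ A B)
  }

∈-tabulate⁻ : (f : Fin n → Bool) {x : Fin n} → x ∈ tabulate f → T (f x)
∈-tabulate⁻ f {x} x∈ = Equivalence.from T-≡ (trans (sym (lookup∘tabulate f x)) ([]=⇒lookup x∈))

∈-tabulate⁺ : (f : Fin n → Bool) {x : Fin n} → T (f x) → x ∈ tabulate f
∈-tabulate⁺ f {x} fx = lookup⇒[]= x _ (trans (lookup∘tabulate f x) (Equivalence.to T-≡ fx))

module _ (M : Matroid n) {X : Subset n} {e : Fin n} where

  ∈cl⁻ : e ∈ cl M X → r M (X ∪ ⁅ e ⁆) ≡ r M X
  ∈cl⁻ e∈ = toWitness (∈-tabulate⁻ _ e∈)

  ∈cl⁺ : r M (X ∪ ⁅ e ⁆) ≡ r M X → e ∈ cl M X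
  ∈cl⁺ eq = ∈-tabulate⁺ _ (fromWitness eq)

⊆-cl : (M : Matroid n) {X : Subset n} → X ⊆ cl M X
⊆-cl M x∈X = ∈cl⁺ M (cong (r M) (x∈p⇒p∪⁅x⁆≡p x∈X))

r[W]≤r[W-e]⇒e∈cl : (M : Matroid n) {W S : Subset n} {e : Fin n} →
                   e ∈ W → r M W ≤ r M (W - e) → W - e ⊆ S → e ∈ cl M S
r[W]≤r[W-e]⇒e∈cl M {W} {S} {e} e∈W r[W]≤r[W-e] W-e⊆S =
  ∈cl⁺ M (ℕ.≤-antisym (ℕ.+-cancelʳ-≤ (r M (S ∩ W)) _ _ grow) (r-mono M _ _ (p⊆p∪q ⁅ e ⁆)))
  where
  ⁅e⁆⊆W : ⁅ e ⁆ ⊆ W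
  ⁅e⁆⊆W y∈ rewrite x∈⁅y⁆⇒x≡y e y∈ = e∈W
  W-e⊆S∩W : W - e ⊆ S ∩ W
  W-e⊆S∩W y∈ = x∈p∩q⁺ (W-e⊆S y∈ , p─q⊆p W ⁅ e ⁆ y∈)
  grow : r M (S ∪ ⁅ e ⁆) + r M (S ∩ W) ≤ r M S + r M (S ∩ W)
  grow = begin
    r M (S ∪ ⁅ e ⁆) + r M (S ∩ W)  ≤⟨ ℕ.+-monoˡ-≤ _ (r-mono M _ _ (∪-monoʳ-⊆ S ⁅e⁆⊆W)) ⟩
    r M (S ∪ W) + r M (S ∩ W)      ≤⟨ r-submod M S W ⟩
    r M S + r M W                  ≤⟨ ℕ.+-monoʳ-≤ (r M S) (ℕ.≤-trans r[W]≤r[W-e] (r-mono M _ _ W-e⊆S∩W)) ⟩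
    r M S + r M (S ∩ W)            ∎
    where open ℕ.≤-Reasoning

module _ (ι : Fin m → Fin n) where

  ∈-img⁻ : ∀ {Z x} → x ∈ img ι Z → ∃ λ i → i ∈ Z × ι i ≡ x
  ∈-img⁻ {Z} {x} x∈ = search (∈-tabulate⁻ _ x∈)
    where
    search : ∀ {m} {Z : Subset m} {ι : Fin m → Fin n} →
             T (anyFin (λ i → lookup Z i ∧ ⌊ ι i ≟ x ⌋)) → ∃ λ i → i ∈ Z × ι i ≡ x
    search {suc m} {b ∷ Z} {ι} t with Equivalence.to T-∨ t
    ... | inj₁ t₀ = let (b≡ , ι₀≡x) = Equivalence.to T-∧ t₀ in
                    zero , lookup⇒[]= zero (b ∷ Z) (Equivalence.to T-≡ b≡) , toWitness ι₀≡x
    ... | inj₂ tₛ = let (i , i∈Z , ιi≡x) = search {Z = Z} {ι ∘ suc} tₛ in suc i , there i∈Z , ιi≡x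

  ∈-img⁺ : ∀ {Z i} → i ∈ Z → ι i ∈ img ι Z
  ∈-img⁺ {Z} {i} i∈Z = ∈-tabulate⁺ _ (found i∈Z)
    where
    found : ∀ {m} {Z : Subset m} {ι : Fin m → Fin n} {i} →
            i ∈ Z → T (anyFin (λ j → lookup Z j ∧ ⌊ ι j ≟ ι i ⌋))
    found {ι = ι} here = Equivalence.from (T-∨ {⌊ ι zero ≟ ι zero ⌋}) (inj₁ (fromWitness refl))
    found (there i∈Z) = Equivalence.from T-∨ (inj₂ (found i∈Z))

  img-mono : ∀ {A B} → A ⊆ B → img ι A ⊆ img ι B
  img-mono A⊆B x∈ with ∈-img⁻ x∈
  ... | i , i∈A , refl = ∈-img⁺ (A⊆B i∈A)

  img-∪ : ∀ A B → img ι (A ∪ B) ≡ img ι A ∪ img ι B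
  img-∪ A B = ⊆-antisym split join
    where
    split : img ι (A ∪ B) ⊆ img ι A ∪ img ι B
    split x∈ with ∈-img⁻ x∈
    ... | i , i∈A∪B , refl with x∈p∪q⁻ A B i∈A∪B
    ...   | inj₁ i∈A = p⊆p∪q (img ι B) (∈-img⁺ i∈A)
    ...   | inj₂ i∈B = q⊆p∪q (img ι A) (img ι B) (∈-img⁺ i∈B)
    join : img ι A ∪ img ι B ⊆ img ι (A ∪ B)
    join x∈ with x∈p∪q⁻ (img ι A) (img ι B) x∈
    ... | inj₁ x∈A = img-mono {A} (p⊆p∪q B) x∈A
    ... | inj₂ x∈B = img-mono {B} (q⊆p∪q A B) x∈B

  img-∩ : ∀ A B → img ι (A ∩ B) ⊆ img ι A ∩ img ι B
  img-∩ A B x∈ with ∈-img⁻ x∈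
  ... | i , i∈A∩B , refl = let (i∈A , i∈B) = x∈p∩q⁻ A B i∈A∩B in x∈p∩q⁺ (∈-img⁺ i∈A , ∈-img⁺ i∈B)

  img-⁅⁆ : ∀ i → img ι ⁅ i ⁆ ≡ ⁅ ι i ⁆
  img-⁅⁆ i = ⊆-antisym onto (λ x∈ → subst (_∈ img ι ⁅ i ⁆) (sym (x∈⁅y⁆⇒x≡y _ x∈)) (∈-img⁺ (x∈⁅x⁆ i)))
    where
    onto : img ι ⁅ i ⁆ ⊆ ⁅ ι i ⁆
    onto x∈ with ∈-img⁻ x∈
    ... | j , j∈ , refl rewrite x∈⁅y⁆⇒x≡y i j∈ = x∈⁅x⁆ (ι i)

∣img∣≡∣∣ : (ι : Fin m → Fin n) → Injective _≡_ _≡_ ι → ∀ Z → ∣ img ι Z ∣ ≡ ∣ Z ∣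
∣img∣≡∣∣ {n = n} ι ι-inj []          =
  trans (cong ∣_∣ (Empty-unique λ (_ , x∈) → no-preimage (∈-img⁻ ι x∈))) (∣⊥∣≡0 n)
  where
  no-preimage : ∀ {x} → ¬ ∃ (λ (i : Fin 0) → i ∈ [] × ι i ≡ x)
  no-preimage ()
∣img∣≡∣∣ ι ι-inj (outside ∷ Z) = ∣img∣≡∣∣ (ι ∘ suc) (suc-injective ∘ ι-inj) Z
∣img∣≡∣∣ ι ι-inj (inside ∷ Z)  = begin
  ∣ img ι (inside ∷ Z) ∣                       ≡⟨ cong (∣_∣ ∘ img ι ∘ (inside ∷_)) (sym (∪-identityˡ Z)) ⟩
  ∣ img ι (⁅ zero ⁆ ∪ (outside ∷ Z)) ∣        ≡⟨ cong ∣_∣ (img-∪ ι ⁅ zero ⁆ (outside ∷ Z)) ⟩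
  ∣ img ι ⁅ zero ⁆ ∪ img (ι ∘ suc) Z ∣        ≡⟨ ∣p∪q∣≡∣p∣+∣q∣ _ _ fresh ⟩
  ∣ img ι ⁅ zero ⁆ ∣ + ∣ img (ι ∘ suc) Z ∣    ≡⟨ cong₂ _+_ (trans (cong ∣_∣ (img-⁅⁆ ι zero)) (∣⁅x⁆∣≡1 (ι zero)))
                                                          (∣img∣≡∣∣ (ι ∘ suc) (suc-injective ∘ ι-inj) Z) ⟩
  suc ∣ Z ∣                                   ∎
  where
  open ≡-Reasoning
  fresh : Disjoint (img ι ⁅ zero ⁆) (img (ι ∘ suc) Z)
  fresh x∈₀ x∈ₛ with ∈-img⁻ ι {⁅ zero ⁆} x∈₀ | ∈-img⁻ (ι ∘ suc) {Z} x∈ₛ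
  ... | i , i∈ , refl | j , _ , ιsj≡ιi with ι-inj {suc j} {i} ιsj≡ιi | x∈⁅y⁆⇒x≡y zero i∈
  ... | () | refl

restriction : (M : Matroid n) (ι : Fin m → Fin n) → Injective _≡_ _≡_ ι → Matroid m
restriction M ι ι-inj = record
  { r        = λ Z → r M (img ι Z)
  ; r-bound  = λ Z → ℕ.≤-trans (r-bound M (img ι Z)) (ℕ.≤-reflexive (∣img∣≡∣∣ ι ι-inj Z))
  ; r-mono   = λ A B A⊆B → r-mono M _ _ (img-mono ι A⊆B)
  ; r-submod = λ A B → ℕ.≤-trans
      (ℕ.+-mono-≤ (ℕ.≤-reflexive (cong (r M) (img-∪ ι A B))) (r-mono M _ _ (img-∩ ι A B)))
      (r-submod M (img ι A) (img ι B))
  }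

record Enumeration (S : Subset n) : Set where
  field
    size      : ℕ
    elem      : Fin size → Fin n
    injective : Injective _≡_ _≡_ elem
    elem-∈    : ∀ i → elem i ∈ S
    onto      : ∀ {x} → x ∈ S → ∃ λ i → elem i ≡ x

  img-elem : img elem Full ≡ S
  img-elem = ⊆-antisym into from
    where
    from : S ⊆ img elem Full
    from x∈S = let (i , elem-i≡x) = onto x∈S in subst (_∈ img elem Full) elem-i≡x (∈-img⁺ elem ∈⊤)
    into : img elem Full ⊆ S
    into x∈ with ∈-img⁻ elem {Full} x∈
    ... | i , _ , refl = elem-∈ i

enumerate : (S : Subset n) → Enumeration S
enumerate []            =
  record { size = 0 ; elem = λ () ; injective = λ { {()} } ; elem-∈ = λ () ; onto = λ () }
enumerate (outside ∷ S) = record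
  { size      = size
  ; elem      = suc ∘ elem
  ; injective = injective ∘ suc-injective
  ; elem-∈    = there ∘ elem-∈
  ; onto      = λ { (there x∈S) → let (i , eq) = onto x∈S in i , cong suc eq }
  }
  where open Enumeration (enumerate S)
enumerate (inside ∷ S)  = record
  { size      = suc size
  ; elem      = elem′
  ; injective = injective′
  ; elem-∈    = λ { zero → here ; (suc i) → there (elem-∈ i) }
  ; onto      = λ { here → zero , refl ; (there x∈S) → let (i , eq) = onto x∈S in suc i , cong suc eq }
  }
  where
  open Enumeration (enumerate S)
  elem′ : Fin (suc size) → Fin _
  elem′ zero    = zero
  elem′ (suc i) = suc (elem i)
  injective′ : Injective _≡_ _≡_ elem′
  injective′ {zero}  {zero}  _  = refl
  injective′ {suc i} {suc j} eq = cong suc (injective (suc-injective eq))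

-- Contracting a circuit down to a uniform matroid

module _ {m k : ℕ} (K : Matroid m) (K-uniform : ∀ A → r K A ≡ ∣ A ∣ ⊓ (m ∸ 1))
         (h : Fin (suc k) → Fin m) (h-inj : Injective _≡_ _≡_ h) (2≤k : 2 ≤ k) where

  private
    C : Subset m
    C = ∁ (img h Full)

    ∣img-h∣ : ∣ img h Full ∣ ≡ suc k
    ∣img-h∣ = trans (∣img∣≡∣∣ h h-inj Full) (∣⊤∣≡n (suc k))

    m∸1≡k+∣C∣ : m ∸ 1 ≡ k + ∣ C ∣
    m∸1≡k+∣C∣ = begin
      m ∸ 1                       ≡⟨ shift (subst (_≤ m) ∣img-h∣ (∣p∣≤n (img h Full))) ⟩
      k + (m ∸ suc k)             ≡⟨ cong (λ s → k + (m ∸ s)) (sym ∣img-h∣) ⟩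
      k + (m ∸ ∣ img h Full ∣)    ≡⟨ cong (k +_) (sym (∣∁p∣≡n∸∣p∣ (img h Full))) ⟩
      k + ∣ C ∣                   ∎
      where
      open ≡-Reasoning
      shift : ∀ {m} → suc k ≤ m → m ∸ 1 ≡ k + (m ∸ suc k)
      shift (s≤s k≤m) = sym (ℕ.m+[n∸m]≡n k≤m)

    rank-C : r K C ≡ ∣ C ∣
    rank-C = begin
      r K C                  ≡⟨ K-uniform C ⟩
      ∣ C ∣ ⊓ (m ∸ 1)        ≡⟨ cong (∣ C ∣ ⊓_) m∸1≡k+∣C∣ ⟩
      ∣ C ∣ ⊓ (k + ∣ C ∣)    ≡⟨ ℕ.m≤n⇒m⊓n≡m (ℕ.m≤n+m ∣ C ∣ k) ⟩
      ∣ C ∣                  ∎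
      where open ≡-Reasoning

    rank-img∪C : ∀ Z → r K (img h Z ∪ C) ≡ r (uniform k (suc k)) Z + r K C
    rank-img∪C Z = begin
      r K (img h Z ∪ C)                  ≡⟨ K-uniform (img h Z ∪ C) ⟩
      ∣ img h Z ∪ C ∣ ⊓ (m ∸ 1)          ≡⟨ cong₂ _⊓_ (∣p∪q∣≡∣p∣+∣q∣ (img h Z) C outside-C) m∸1≡k+∣C∣ ⟩
      (∣ img h Z ∣ + ∣ C ∣) ⊓ (k + ∣ C ∣) ≡⟨ cong (λ s → (s + ∣ C ∣) ⊓ (k + ∣ C ∣)) (∣img∣≡∣∣ h h-inj Z) ⟩
      (∣ Z ∣ + ∣ C ∣) ⊓ (k + ∣ C ∣)       ≡⟨ ℕ.+-distribʳ-⊓ ∣ C ∣ ∣ Z ∣ k ⟨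
      ∣ Z ∣ ⊓ k + ∣ C ∣                  ≡⟨ cong (∣ Z ∣ ⊓ k +_) rank-C ⟨
      ∣ Z ∣ ⊓ k + r K C                  ∎
      where
      open ≡-Reasoning
      outside-C : Disjoint (img h Z) C
      outside-C x∈ = x∈p⇒x∉∁p (img-mono h {Z} ⊆⊤ x∈)

    rank-C∪img : ∀ Z → r K (C ∪ img h Z) ≡ ∣ Z ∣ ⊓ k + r K C
    rank-C∪img Z = trans (cong (r K) (∪-comm C (img h Z))) (rank-img∪C Z)

    rank-C∪⁅⁆ : ∀ i → r K (C ∪ ⁅ h i ⁆) ≡ suc (r K C)
    rank-C∪⁅⁆ i = begin
      r K (C ∪ ⁅ h i ⁆)          ≡⟨ cong (r K ∘ (C ∪_)) (img-⁅⁆ h i) ⟨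
      r K (C ∪ img h ⁅ i ⁆)      ≡⟨ rank-C∪img ⁅ i ⁆ ⟩
      ∣ ⁅ i ⁆ ∣ ⊓ k + r K C      ≡⟨ cong (λ s → s ⊓ k + r K C) (∣⁅x⁆∣≡1 i) ⟩
      1 ⊓ k + r K C              ≡⟨ cong (_+ r K C) (ℕ.m≤n⇒m⊓n≡m (ℕ.≤-trans (s≤s z≤n) 2≤k)) ⟩
      suc (r K C)                ∎
      where open ≡-Reasoning

    rank-C∪pair : ∀ {i j} → i ≢ j → r K (C ∪ (⁅ h i ⁆ ∪ ⁅ h j ⁆)) ≡ 2 + r K C
    rank-C∪pair {i} {j} i≢j = begin
      r K (C ∪ (⁅ h i ⁆ ∪ ⁅ h j ⁆))        ≡⟨ cong (r K ∘ (C ∪_)) (cong₂ _∪_ (img-⁅⁆ h i) (img-⁅⁆ h j)) ⟨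
      r K (C ∪ (img h ⁅ i ⁆ ∪ img h ⁅ j ⁆)) ≡⟨ cong (r K ∘ (C ∪_)) (img-∪ h ⁅ i ⁆ ⁅ j ⁆) ⟨
      r K (C ∪ img h (⁅ i ⁆ ∪ ⁅ j ⁆))       ≡⟨ rank-C∪img (⁅ i ⁆ ∪ ⁅ j ⁆) ⟩
      ∣ ⁅ i ⁆ ∪ ⁅ j ⁆ ∣ ⊓ k + r K C         ≡⟨ cong (λ s → s ⊓ k + r K C) (∣⁅x⁆∪⁅y⁆∣≡2 i≢j) ⟩
      2 ⊓ k + r K C                         ≡⟨ cong (_+ r K C) (ℕ.m≤n⇒m⊓n≡m 2≤k) ⟩
      2 + r K C                             ∎
      where open ≡-Reasoning

  contract-uniform : ContractSimp K (uniform k (suc k))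
  contract-uniform = C , h , loopless , no-parallel , represented , λ Z → sym (rank-img∪C Z)
    where
    loopless : ∀ i → h i ∉ cl K C
    loopless i h-i∈cl = ℕ.1+n≢n (trans (sym (rank-C∪⁅⁆ i)) (∈cl⁻ K h-i∈cl))
    no-parallel : ∀ i j → i ≢ j → ¬ ParallelIn/ K C (h i) (h j)
    no-parallel i j i≢j parallel = ℕ.1+n≢n (ℕ.suc-injective (trans (sym (rank-C∪pair i≢j)) parallel))
    represented : ∀ e → e ∉ cl K C → ∃ λ i → ParallelIn/ K C e (h i)
    represented e e∉cl with ∈-img⁻ h {Full} (x∉∁p⇒x∈p λ e∈C → e∉cl (⊆-cl K e∈C))
    ... | i , _ , refl = i , trans (cong (r K ∘ (C ∪_)) (∪-idem ⁅ h i ⁆)) (rank-C∪⁅⁆ i)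

induced-uniform : ∀ {n k} (M : Matroid n) {D : Subset n} → IsFlat M D →
                  (∀ A → A ⊆ D → r M A ≡ ∣ A ∣ ⊓ (∣ D ∣ ∸ 1)) →
                  (g : Fin (suc k) → Fin n) → Injective _≡_ _≡_ g → (∀ i → g i ∈ D) →
                  2 ≤ k → InducedMinor M (uniform k (suc k))
induced-uniform M {D} D-flat D-uniform g g-inj g∈D 2≤k =
  restr {K = K} (elem , injective , subst (IsFlat M) (sym img-elem) D-flat , λ _ → refl)
        (contr (contract-uniform K K-uniform h h-inj 2≤k) done)
  where
  open Enumeration (enumerate D)
  K : Matroid size
  K = restriction M elem injective
  ∣D∣≡size : ∣ D ∣ ≡ size
  ∣D∣≡size = trans (cong ∣_∣ (sym img-elem)) (trans (∣img∣≡∣∣ elem injective Full) (∣⊤∣≡n size))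
  K-uniform : ∀ A → r K A ≡ ∣ A ∣ ⊓ (size ∸ 1)
  K-uniform A = begin
    r M (img elem A)               ≡⟨ D-uniform (img elem A) (subst (img elem A ⊆_) img-elem (img-mono elem {A} ⊆⊤)) ⟩
    ∣ img elem A ∣ ⊓ (∣ D ∣ ∸ 1)   ≡⟨ cong₂ (λ a s → a ⊓ (s ∸ 1)) (∣img∣≡∣∣ elem injective A) ∣D∣≡size ⟩
    ∣ A ∣ ⊓ (size ∸ 1)             ∎
    where open ≡-Reasoning
  h : Fin _ → Fin size
  h i = proj₁ (onto (g∈D i))
  h-inj : Injective _≡_ _≡_ h
  h-inj {i} {j} h-i≡h-j =
    g-inj (trans (sym (proj₂ (onto (g∈D i)))) (trans (cong elem h-i≡h-j) (proj₂ (onto (g∈D j)))))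

module Represented {n d : ℕ} (M : Matroid n) (φ : Fin n → Vec Bool d)
              (rk : ∀ X → IsGF2RankOf φ X (r M X)) where

  Cycle : Subset n → Set
  Cycle Z = sumOver φ Z ≡ 0ᵛ

  cycle? : ∀ Z → Dec (Cycle Z)
  cycle? Z = ≡-dec _≟ᵇ_ (sumOver φ Z) 0ᵛ

  NonemptyCycle : Subset n → Set
  NonemptyCycle Z = Nonempty Z × Cycle Z

  Circuit : Subset n → Set
  Circuit = Minimal NonemptyCycle

  indep⇒r≡∣∣ : ∀ {I} → GF2Indep φ I → r M I ≡ ∣ I ∣
  indep⇒r≡∣∣ {I} I-indep = ℕ.≤-antisym (r-bound M I) (proj₂ (rk I) I ⊆-refl I-indep)

  cycle⇒r<∣∣ : ∀ {Z} → NonemptyCycle Z → r M Z < ∣ Z ∣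
  cycle⇒r<∣∣ {Z} (Z≢∅ , Z-cycle) with ∣ Z ∣ ≤? r M Z | proj₁ (rk Z)
  ... | no  ∣Z∣≰r  | _ = ℕ.≰⇒> ∣Z∣≰r
  ... | yes ∣Z∣≤r | I , I⊆Z , I-indep , ∣I∣≡r =
    ⊥-elim (I-indep Z (p⊆q∧∣q∣≤∣p∣⇒q⊆p I⊆Z (subst (∣ Z ∣ ≤_) (sym ∣I∣≡r) ∣Z∣≤r)) Z≢∅ Z-cycle)

  circuit-proper-indep : ∀ {D A x} → Circuit D → A ⊆ D → x ∈ D → x ∉ A → GF2Indep φ A
  circuit-proper-indep (_ , D-least) A⊆D x∈D x∉A J J⊆A J≢∅ J-cycle =
    x∉A (J⊆A (D-least (⊆-trans J⊆A A⊆D) (J≢∅ , J-cycle) x∈D))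

  circuit-r≤r-delete : ∀ {D x} → Circuit D → x ∈ D → r M D ≤ r M (D - x)
  circuit-r≤r-delete {D} {x} D-circuit x∈D = ℕ.≤-pred (begin-strict
    r M D               <⟨ cycle⇒r<∣∣ (proj₁ D-circuit) ⟩
    ∣ D ∣               ≡⟨ x∈p⇒1+∣p-x∣≡∣p∣ x∈D ⟨
    suc ∣ D - x ∣       ≡⟨ cong suc (indep⇒r≡∣∣ (circuit-proper-indep D-circuit (p─q⊆p D ⁅ x ⁆) x∈D (x∉p-x D x))) ⟨
    suc (r M (D - x))   ∎)
    where open ℕ.≤-Reasoning

  circuit-rank : ∀ {D A} → Circuit D → A ⊆ D → r M A ≡ ∣ A ∣ ⊓ (∣ D ∣ ∸ 1)
  circuit-rank {D} {A} D-circuit A⊆D with D ⊆? A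
  ... | no D⊈A = let (x , x∈D , x∉A) = p⊈q⇒∃ D⊈A in begin
    r M A                 ≡⟨ indep⇒r≡∣∣ (circuit-proper-indep D-circuit A⊆D x∈D x∉A) ⟩
    ∣ A ∣                 ≡⟨ ℕ.m≤n⇒m⊓n≡m (ℕ.<⇒≤pred (p⊂q⇒∣p∣<∣q∣ (A⊆D , x , x∈D , x∉A))) ⟨
    ∣ A ∣ ⊓ (∣ D ∣ ∸ 1)   ∎
    where open ≡-Reasoning
  ... | yes D⊆A with ⊆-antisym A⊆D D⊆A | proj₁ (proj₁ D-circuit)
  ...   | refl | x , x∈D = begin
    r M D                 ≡⟨ ℕ.≤-antisym (circuit-r≤r-delete D-circuit x∈D) (r-mono M _ _ (p─q⊆p D ⁅ x ⁆)) ⟩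
    r M (D - x)           ≡⟨ indep⇒r≡∣∣ (circuit-proper-indep D-circuit (p─q⊆p D ⁅ x ⁆) x∈D (x∉p-x D x)) ⟩
    ∣ D - x ∣             ≡⟨ cong (_∸ 1) (x∈p⇒1+∣p-x∣≡∣p∣ x∈D) ⟩
    ∣ D ∣ ∸ 1             ≡⟨ ℕ.m≥n⇒m⊓n≡n (ℕ.m∸n≤m ∣ D ∣ 1) ⟨
    ∣ D ∣ ⊓ (∣ D ∣ ∸ 1)   ∎
    where open ≡-Reasoning

  ∃-circuit⊆ : ∀ {Z} → NonemptyCycle Z → ∃ λ W → W ⊆ Z × Circuit W
  ∃-circuit⊆ = ∃-minimal (λ Z → nonempty? Z ×-dec cycle? Z)

  dependent⇒∃-circuit⊆ : ∀ {Z} → ¬ GF2Indep φ Z → ∃ λ W → W ⊆ Z × Circuit W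
  dependent⇒∃-circuit⊆ {Z} Z-dependent with anySubset? (λ J → (J ⊆? Z) ×-dec (nonempty? J ×-dec cycle? J))
  ... | yes (J , J⊆Z , J-cycle) = let (W , W⊆J , W-circuit) = ∃-circuit⊆ J-cycle in W , ⊆-trans W⊆J J⊆Z , W-circuit
  ... | no  ¬cycle = ⊥-elim (Z-dependent λ J J⊆Z J≢∅ J-cycle → ¬cycle (J , J⊆Z , J≢∅ , J-cycle))

  -- A minimal cycle through e is a circuit: a nonempty cycle J ⊆ W avoiding e would make W ─ J
  -- a smaller cycle through e.
  ∃-circuit∋ : ∀ {Z e} → Cycle Z → e ∈ Z → ∃ λ W → W ⊆ Z × e ∈ W × Circuit W
  ∃-circuit∋ {Z} {e} Z-cycle e∈Z with ∃-minimal (λ J → (e ∈? J) ×-dec cycle? J) (e∈Z , Z-cycle)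
  ... | W , W⊆Z , (e∈W , W-cycle) , W-least = W , W⊆Z , e∈W , ((e , e∈W) , W-cycle) , least
    where
    least : ∀ {J} → J ⊆ W → NonemptyCycle J → W ⊆ J
    least {J} J⊆W (J≢∅ , J-cycle) with e ∈? J
    ... | yes e∈J = W-least J⊆W (e∈J , J-cycle)
    ... | no  e∉J = ⊥-elim (x∈p─q⇒x∉q {p = W} (W⊆W─J (J⊆W j∈J)) j∈J)
      where
      j∈J = proj₂ J≢∅
      W─J-cycle : Cycle (W ─ J)
      W─J-cycle = trans (sumOver-─ φ J⊆W) (trans (cong₂ _⊕_ W-cycle J-cycle) (⊕-self 0ᵛ))
      W⊆W─J : W ⊆ W ─ J
      W⊆W─J = W-least (p─q⊆p W J) (x∈p∧x∉q⇒x∈p─q e∈W e∉J , W─J-cycle)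

  circuit-∈cl : ∀ {D B a} → Circuit D → a ∈ D → D - a ⊆ B → a ∈ cl M B
  circuit-∈cl D-circuit a∈D = r[W]≤r[W-e]⇒e∈cl M a∈D (circuit-r≤r-delete D-circuit a∈D)

  ∪⁅e⁆-cycle : ∀ {T e} → e ∉ T → sumOver φ T ≡ φ e → Cycle (T ∪ ⁅ e ⁆)
  ∪⁅e⁆-cycle {T} {e} e∉T ΣT≡φe = begin
    sumOver φ (T ∪ ⁅ e ⁆)                ≡⟨ sumOver-∪ φ T#e ⟩
    sumOver φ T ⊕ sumOver φ ⁅ e ⁆        ≡⟨ cong₂ _⊕_ ΣT≡φe (sumOver-⁅⁆ φ e) ⟩
    φ e ⊕ φ e                            ≡⟨ ⊕-self (φ e) ⟩
    0ᵛ                                   ∎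
    where
    open ≡-Reasoning
    T#e : Disjoint T ⁅ e ⁆
    T#e y∈T y∈⁅e⁆ rewrite x∈⁅y⁆⇒x≡y e y∈⁅e⁆ = e∉T y∈T

  Spans : Subset n → Fin n → Set
  Spans S e = ∃ λ T → T ⊆ S × sumOver φ T ≡ φ e

  ¬spans⇒indep-∪⁅e⁆ : ∀ {S I e} → ¬ Spans S e → I ⊆ S → GF2Indep φ I → GF2Indep φ (I ∪ ⁅ e ⁆)
  ¬spans⇒indep-∪⁅e⁆ {S} {I} {e} ¬spans I⊆S I-indep J J⊆I+e J≢∅ J-cycle with e ∈? J
  ... | no  e∉J = I-indep J J⊆I J≢∅ J-cycle
    where
    J⊆I : J ⊆ I
    J⊆I y∈J with x∈p∪q⁻ I ⁅ e ⁆ (J⊆I+e y∈J)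
    ... | inj₁ y∈I   = y∈I
    ... | inj₂ y∈⁅e⁆ rewrite x∈⁅y⁆⇒x≡y e y∈⁅e⁆ = ⊥-elim (e∉J y∈J)
  ... | yes e∈J = ¬spans (J - e , J-e⊆S , ΣJ-e≡φe)
    where
    J-e⊆S : J - e ⊆ S
    J-e⊆S y∈ with x∈p∪q⁻ I ⁅ e ⁆ (J⊆I+e (p─q⊆p J ⁅ e ⁆ y∈))
    ... | inj₁ y∈I   = I⊆S y∈I
    ... | inj₂ y∈⁅e⁆ = ⊥-elim (y∈p-x⇒y≢x {p = J} y∈ (x∈⁅y⁆⇒x≡y e y∈⁅e⁆))
    ΣJ-e≡φe : sumOver φ (J - e) ≡ φ e
    ΣJ-e≡φe = begin
      sumOver φ (J - e)                 ≡⟨ sumOver-─ φ (λ y∈ → subst (_∈ J) (sym (x∈⁅y⁆⇒x≡y e y∈)) e∈J) ⟩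
      sumOver φ J ⊕ sumOver φ ⁅ e ⁆     ≡⟨ cong₂ _⊕_ J-cycle (sumOver-⁅⁆ φ e) ⟩
      0ᵛ ⊕ φ e                          ≡⟨ ⊕-identityˡ (φ e) ⟩
      φ e                               ∎
      where open ≡-Reasoning

  ∈cl⇒spans : ∀ {S e} → e ∈ cl M S → Spans S e
  ∈cl⇒spans {S} {e} e∈cl with anySubset? (λ T → (T ⊆? S) ×-dec ≡-dec _≟ᵇ_ (sumOver φ T) (φ e))
  ... | yes spans = spans
  ... | no  ¬spans with proj₁ (rk S)
  ...   | I , I⊆S , I-indep , ∣I∣≡r = ⊥-elim (ℕ.<⇒≱ ∣I∣<∣I+e∣ ∣I+e∣≤∣I∣)
    where
    e∉I : e ∉ I
    e∉I e∈I = ¬spans (⁅ e ⁆ , (λ y∈ → subst (_∈ S) (sym (x∈⁅y⁆⇒x≡y e y∈)) (I⊆S e∈I)) , sumOver-⁅⁆ φ e)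
    ∣I∣<∣I+e∣ : ∣ I ∣ < ∣ I ∪ ⁅ e ⁆ ∣
    ∣I∣<∣I+e∣ = p⊂q⇒∣p∣<∣q∣ (p⊆p∪q ⁅ e ⁆ , e , q⊆p∪q I ⁅ e ⁆ (x∈⁅x⁆ e) , e∉I)
    ∣I+e∣≤∣I∣ : ∣ I ∪ ⁅ e ⁆ ∣ ≤ ∣ I ∣
    ∣I+e∣≤∣I∣ = begin
      ∣ I ∪ ⁅ e ⁆ ∣      ≡⟨ indep⇒r≡∣∣ (¬spans⇒indep-∪⁅e⁆ ¬spans I⊆S I-indep) ⟨
      r M (I ∪ ⁅ e ⁆)    ≤⟨ r-mono M _ _ (∪-monoˡ-⊆ ⁅ e ⁆ I⊆S) ⟩
      r M (S ∪ ⁅ e ⁆)    ≡⟨ ∈cl⁻ M e∈cl ⟩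
      r M S              ≡⟨ ∣I∣≡r ⟨
      ∣ I ∣              ∎
      where open ℕ.≤-Reasoning

  Meets : Subset n → Subset n → Set
  Meets W A = Nonempty (W ∩ A)

  Meets-mono : ∀ {W A B} → A ⊆ B → Meets W A → Meets W B
  Meets-mono {W} {A} A⊆B (x , x∈W∩A) = let (x∈W , x∈A) = x∈p∩q⁻ W A x∈W∩A in x , x∈p∩q⁺ (x∈W , A⊆B x∈A)

  circuit⊆∪-meets : ∀ {W I J} → Circuit W → W ⊆ I ∪ J → GF2Indep φ I → Meets W J
  circuit⊆∪-meets {W} {I} {J} (W-cycle , _) W⊆I∪J I-indep with nonempty? (W ∩ J)
  ... | yes meets = meets
  ... | no  ¬meets = ⊥-elim (I-indep W W⊆I (proj₁ W-cycle) (proj₂ W-cycle))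
    where
    W⊆I : W ⊆ I
    W⊆I {w} w∈W with x∈p∪q⁻ I J (W⊆I∪J w∈W)
    ... | inj₁ w∈I = w∈I
    ... | inj₂ w∈J = ⊥-elim (¬meets (w , x∈p∩q⁺ (w∈W , w∈J)))

  circuit-meets-twice : ∀ {D A B a} → Circuit D → (∀ z → z ∈ A ⊎ z ∈ B) → Disjoint (cl M A) (cl M B) →
                        a ∈ D → a ∈ A → ∃ λ a′ → a′ ≢ a × a′ ∈ D × a′ ∈ A
  circuit-meets-twice {D} {A} {B} {a} D-circuit cover clA#clB a∈D a∈A
    with any? (λ z → ¬? (z ≟ a) ×-dec (z ∈? D) ×-dec (z ∈? A))
  ... | yes second = second
  ... | no  ¬second = ⊥-elim (clA#clB (⊆-cl M a∈A) (circuit-∈cl D-circuit a∈D D-a⊆B))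
    where
    D-a⊆B : D - a ⊆ B
    D-a⊆B {z} z∈ with cover z
    ... | inj₂ z∈B = z∈B
    ... | inj₁ z∈A = ⊥-elim (¬second (z , y∈p-x⇒y≢x {p = D} z∈ , p─q⊆p D ⁅ a ⁆ z∈ , z∈A))

  circuit-sum-─ : ∀ {D S} → Circuit D → S ⊆ D → sumOver φ (D ─ S) ≡ sumOver φ S
  circuit-sum-─ ((_ , D-cycle) , _) S⊆D =
    trans (sumOver-─ φ S⊆D) (trans (cong (_⊕ _) D-cycle) (⊕-identityˡ _))

  smaller-circuit : ∀ {D T x y} → Circuit D → x ∉ D → T ⊆ D → sumOver φ T ≡ φ x → y ∈ T →
                    TwoElements (D ─ T) → ∃ λ W → Circuit W × x ∈ W × y ∈ W × ∣ W ∣ < ∣ D ∣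
  smaller-circuit {D} {T} {x} {y} D-circuit x∉D T⊆D ΣT≡φx y∈T (s , t , s≢t , s∈D─T , t∈D─T)
    with ∃-circuit∋ (∪⁅e⁆-cycle (x∉D ∘ T⊆D) ΣT≡φx) (p⊆p∪q ⁅ x ⁆ y∈T)
  ... | W , W⊆T+x , y∈W , W-circuit = W , W-circuit , x∈W , y∈W , ∣W∣<∣D∣
    where
    s∉T : s ∉ T
    s∉T = x∈p─q⇒x∉q {p = D} s∈D─T
    x∈W : x ∈ W
    x∈W with x ∈? W
    ... | yes x∈W = x∈W
    ... | no  x∉W = ⊥-elim (s∉T (W⊆T (proj₂ D-circuit (⊆-trans W⊆T T⊆D) (proj₁ W-circuit) (p─q⊆p D T s∈D─T))))
      where
      W⊆T : W ⊆ T
      W⊆T {w} w∈W with x∈p∪q⁻ T ⁅ x ⁆ (W⊆T+x w∈W)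
      ... | inj₁ w∈T   = w∈T
      ... | inj₂ w∈⁅x⁆ rewrite x∈⁅y⁆⇒x≡y x w∈⁅x⁆ = ⊥-elim (x∉W w∈W)
    T⊂D-s : T ⊂ D - s
    T⊂D-s = (λ {z} z∈T → x∈p∧x≢y⇒x∈p-y (T⊆D z∈T) λ { refl → s∉T z∈T })
          , t , x∈p∧x≢y⇒x∈p-y (p─q⊆p D T t∈D─T) (s≢t ∘ sym) , x∈p─q⇒x∉q {p = D} t∈D─T
    ∣W∣<∣D∣ : ∣ W ∣ < ∣ D ∣
    ∣W∣<∣D∣ = begin-strict
      ∣ W ∣                  ≤⟨ p⊆q⇒∣p∣≤∣q∣ W⊆T+x ⟩
      ∣ T ∪ ⁅ x ⁆ ∣          ≤⟨ ∣p∪q∣≤∣p∣+∣q∣ T ⁅ x ⁆ ⟩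
      ∣ T ∣ + ∣ ⁅ x ⁆ ∣      ≡⟨ trans (cong (∣ T ∣ +_) (∣⁅x⁆∣≡1 x)) (ℕ.+-comm ∣ T ∣ 1) ⟩
      suc ∣ T ∣              ≤⟨ p⊂q⇒∣p∣<∣q∣ T⊂D-s ⟩
      ∣ D - s ∣              <⟨ x∈p⇒∣p-x∣<∣p∣ (p─q⊆p D T s∈D─T) ⟩
      ∣ D ∣                  ∎
      where open ℕ.≤-Reasoning

  split-circuit : ∀ {D S x A B} → Circuit D → x ∉ D → S ⊆ D → sumOver φ S ≡ φ x →
                  TwoElements S → TwoElements (D ─ S) → x ∈ A → Meets D B →
                  ∃ λ W → Circuit W × Meets W A × Meets W B × ∣ W ∣ < ∣ D ∣
  split-circuit {D} {S} {x} {B = B} D-circuit x∉D S⊆D ΣS≡φx two-S two-D─S x∈A (y , y∈D∩B)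
    with x∈p∩q⁻ D B y∈D∩B
  ... | y∈D , y∈B = let (W , W-circuit , x∈W , y∈W , smaller) = through-y
                    in W , W-circuit , (x , x∈p∩q⁺ (x∈W , x∈A)) , (y , x∈p∩q⁺ (y∈W , y∈B)) , smaller
    where
    S⊆D─[D─S] : S ⊆ D ─ (D ─ S)
    S⊆D─[D─S] z∈S = x∈p∧x∉q⇒x∈p─q (S⊆D z∈S) (λ z∈D─S → x∈p─q⇒x∉q {p = D} z∈D─S z∈S)
    through-y : ∃ λ W → Circuit W × x ∈ W × y ∈ W × ∣ W ∣ < ∣ D ∣
    through-y with y ∈? S
    ... | yes y∈S = smaller-circuit D-circuit x∉D S⊆D ΣS≡φx y∈S two-D─S
    ... | no  y∉S = smaller-circuit D-circuit x∉D (p─q⊆p D S) (trans (circuit-sum-─ D-circuit S⊆D) ΣS≡φx)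
                      (x∈p∧x∉q⇒x∈p─q y∈D y∉S) (TwoElements-mono S⊆D─[D─S] two-S)

  module Simplicity (M-simple : Simple M) where

    φ≢0 : ∀ x → φ x ≢ 0ᵛ
    φ≢0 x φx≡0 = ℕ.<-irrefl (trans (proj₁ M-simple x) (sym (∣⁅x⁆∣≡1 x)))
      (cycle⇒r<∣∣ ((x , x∈⁅x⁆ x) , trans (sumOver-⁅⁆ φ x) φx≡0))

    φ-injective : ∀ {x y} → φ x ≡ φ y → x ≡ y
    φ-injective {x} {y} φx≡φy with x ≟ y
    ... | yes x≡y = x≡y
    ... | no  x≢y = ⊥-elim (ℕ.<-irrefl (trans (proj₂ M-simple x y x≢y) (sym (∣⁅x⁆∪⁅y⁆∣≡2 x≢y)))
                       (cycle⇒r<∣∣ ((x , p⊆p∪q ⁅ y ⁆ (x∈⁅x⁆ x)) , pair-cycle)))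
      where
      x∉⁅y⁆ : Disjoint ⁅ x ⁆ ⁅ y ⁆
      x∉⁅y⁆ z∈x z∈y = x≢y (trans (sym (x∈⁅y⁆⇒x≡y x z∈x)) (x∈⁅y⁆⇒x≡y y z∈y))
      pair-cycle : Cycle (⁅ x ⁆ ∪ ⁅ y ⁆)
      pair-cycle = begin
        sumOver φ (⁅ x ⁆ ∪ ⁅ y ⁆)             ≡⟨ sumOver-∪ φ x∉⁅y⁆ ⟩
        sumOver φ ⁅ x ⁆ ⊕ sumOver φ ⁅ y ⁆     ≡⟨ cong₂ _⊕_ (sumOver-⁅⁆ φ x) (sumOver-⁅⁆ φ y) ⟩
        φ x ⊕ φ y                             ≡⟨ cong (φ x ⊕_) φx≡φy ⟨
        φ x ⊕ φ x                             ≡⟨ ⊕-self (φ x) ⟩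
        0ᵛ                                    ∎
        where open ≡-Reasoning

    ¬two⇒sum∈ : ∀ {A x} → ¬ TwoElements A → sumOver φ A ≡ φ x → x ∈ A
    ¬two⇒sum∈ {A} {x} ¬two ΣA≡φx with nonempty? A
    ... | no  A≡∅ = ⊥-elim (φ≢0 x (trans (sym ΣA≡φx) (trans (cong (sumOver φ) (Empty-unique A≡∅)) (sumOver-∅ φ))))
    ... | yes (s , s∈A) = subst (_∈ A) (sym x≡s) s∈A
      where
      A≡⁅s⁆ : A ≡ ⁅ s ⁆
      A≡⁅s⁆ = ⊆-antisym only-s (λ y∈ → subst (_∈ A) (sym (x∈⁅y⁆⇒x≡y s y∈)) s∈A)
        where
        only-s : A ⊆ ⁅ s ⁆
        only-s {y} y∈A with y ≟ s
        ... | yes refl = x∈⁅x⁆ s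
        ... | no  y≢s  = ⊥-elim (¬two (y , s , y≢s , y∈A , s∈A))
      x≡s : x ≡ s
      x≡s = φ-injective (trans (sym ΣA≡φx) (trans (cong (sumOver φ) A≡⁅s⁆) (sumOver-⁅⁆ φ s)))

  module Separation (M-simple : Simple M) {X Y : Subset n} (cover : ∀ z → z ∈ X ⊎ z ∈ Y)
                    (X#Y : Disjoint X Y) (clX#clY : Disjoint (cl M X) (cl M Y)) where

    open Simplicity M-simple

    escape : ∀ {D x} → Circuit D → x ∈ cl M D → x ∉ D → Meets D X → Meets D Y →
             ∃ λ W → Circuit W × Meets W X × Meets W Y × ∣ W ∣ < ∣ D ∣
    escape {D} {x} D-circuit x∈cl x∉D meets-X meets-Y with ∈cl⇒spans x∈cl
    ... | S , S⊆D , ΣS≡φx with twoElements? S | twoElements? (D ─ S)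
    ...   | no ¬two-S | _ = ⊥-elim (x∉D (S⊆D (¬two⇒sum∈ ¬two-S ΣS≡φx)))
    ...   | yes _ | no ¬two-D─S =
      ⊥-elim (x∉D (p─q⊆p D S (¬two⇒sum∈ ¬two-D─S (trans (circuit-sum-─ D-circuit S⊆D) ΣS≡φx))))
    ...   | yes two-S | yes two-D─S with cover x
    ...     | inj₁ x∈X = split-circuit D-circuit x∉D S⊆D ΣS≡φx two-S two-D─S x∈X meets-Y
    ...     | inj₂ x∈Y = let (W , W-circuit , W-meets-Y , W-meets-X , smaller)
                               = split-circuit D-circuit x∉D S⊆D ΣS≡φx two-S two-D─S x∈Y meets-X
                         in W , W-circuit , W-meets-X , W-meets-Y , smaller

    ∃-flat-circuit : ∀ {D} → Circuit D → Meets D X → Meets D Y →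
                     ∃ λ F → Circuit F × Meets F X × Meets F Y × cl M F ⊆ F
    ∃-flat-circuit {D} = All.wfRec (On.wellFounded ∣_∣ ℕ.<-wellFounded) 0ℓ Goal step D
      where
      Goal : Subset n → Set
      Goal D = Circuit D → Meets D X → Meets D Y → ∃ λ F → Circuit F × Meets F X × Meets F Y × cl M F ⊆ F
      step : ∀ D → (∀ {W} → ∣ W ∣ < ∣ D ∣ → Goal W) → Goal D
      step D smaller⇒goal D-circuit meets-X meets-Y with cl M D ⊆? D
      ... | yes cl⊆D = D , D-circuit , meets-X , meets-Y , cl⊆D
      ... | no  cl⊈D =
        let (x , x∈cl , x∉D) = p⊈q⇒∃ cl⊈D
            (W , W-circuit , W-meets-X , W-meets-Y , smaller) = escape D-circuit x∈cl x∉D meets-X meets-Y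
        in smaller⇒goal smaller W-circuit W-meets-X W-meets-Y

    ∃-crossing-circuit : ∀ {k} → 2 ≤ k → r M X + r M Y ≡ r M Full + (k ∸ 1) →
                         ∃ λ D → Circuit D × Meets D X × Meets D Y
    ∃-crossing-circuit {k} 2≤k exact with proj₁ (rk X) | proj₁ (rk Y)
    ... | I , I⊆X , I-indep , ∣I∣≡rX | J , J⊆Y , J-indep , ∣J∣≡rY =
      let (W , W⊆I∪J , W-circuit) = dependent⇒∃-circuit⊆ I∪J-dependent
      in W , W-circuit
           , Meets-mono I⊆X (circuit⊆∪-meets W-circuit (subst (W ⊆_) (∪-comm I J) W⊆I∪J) J-indep)
           , Meets-mono J⊆Y (circuit⊆∪-meets W-circuit W⊆I∪J I-indep)
      where
      ∣I∪J∣≡ : ∣ I ∪ J ∣ ≡ r M Full + (k ∸ 1)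
      ∣I∪J∣≡ = trans (∣p∪q∣≡∣p∣+∣q∣ I J (λ x∈I x∈J → X#Y (I⊆X x∈I) (J⊆Y x∈J)))
                     (trans (cong₂ _+_ ∣I∣≡rX ∣J∣≡rY) exact)
      I∪J-dependent : ¬ GF2Indep φ (I ∪ J)
      I∪J-dependent I∪J-indep = ℕ.<⇒≱ (begin-strict
        r M Full                ≡⟨ ℕ.+-identityʳ _ ⟨
        r M Full + 0            <⟨ ℕ.+-monoʳ-< (r M Full) (ℕ.∸-monoˡ-< 2≤k (s≤s z≤n)) ⟩
        r M Full + (k ∸ 1)      ≡⟨ ∣I∪J∣≡ ⟨
        ∣ I ∪ J ∣               ∎) (proj₂ (rk Full) (I ∪ J) ⊆⊤ I∪J-indep)
        where open ℕ.≤-Reasoning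

    crossing-quadruple : ∀ {D} → Circuit D → Meets D X → Meets D Y →
                         ∃ λ (g : Fin 4 → Fin n) → Injective _≡_ _≡_ g × (∀ i → g i ∈ D)
    crossing-quadruple {D} D-circuit (a₁ , a₁∈D∩X) (b₁ , b₁∈D∩Y)
      with x∈p∩q⁻ D X a₁∈D∩X | x∈p∩q⁻ D Y b₁∈D∩Y
    ... | a₁∈D , a₁∈X | b₁∈D , b₁∈Y
      with circuit-meets-twice D-circuit cover clX#clY a₁∈D a₁∈X
         | circuit-meets-twice D-circuit (swap ∘ cover) (λ p q → clX#clY q p) b₁∈D b₁∈Y
    ... | a₂ , a₂≢a₁ , a₂∈D , a₂∈X | b₂ , b₂≢b₁ , b₂∈D , b₂∈Y = g , g-inj , g∈D
      where
      g : Fin 4 → Fin n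
      g = lookup (a₁ ∷ a₂ ∷ b₁ ∷ b₂ ∷ [])
      g∈D : ∀ i → g i ∈ D
      g∈D 0F = a₁∈D
      g∈D 1F = a₂∈D
      g∈D 2F = b₁∈D
      g∈D 3F = b₂∈D
      across : ∀ {a b} → a ∈ X → b ∈ Y → a ≢ b
      across a∈X b∈Y refl = X#Y a∈X b∈Y
      g-inj : Injective _≡_ _≡_ g
      g-inj {0F} {0F} _  = refl
      g-inj {0F} {1F} eq = ⊥-elim (a₂≢a₁ (sym eq))
      g-inj {0F} {2F} eq = ⊥-elim (across a₁∈X b₁∈Y eq)
      g-inj {0F} {3F} eq = ⊥-elim (across a₁∈X b₂∈Y eq)
      g-inj {1F} {0F} eq = ⊥-elim (a₂≢a₁ eq)
      g-inj {1F} {1F} _  = refl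
      g-inj {1F} {2F} eq = ⊥-elim (across a₂∈X b₁∈Y eq)
      g-inj {1F} {3F} eq = ⊥-elim (across a₂∈X b₂∈Y eq)
      g-inj {2F} {0F} eq = ⊥-elim (across a₁∈X b₁∈Y (sym eq))
      g-inj {2F} {1F} eq = ⊥-elim (across a₂∈X b₁∈Y (sym eq))
      g-inj {2F} {2F} _  = refl
      g-inj {2F} {3F} eq = ⊥-elim (b₂≢b₁ (sym eq))
      g-inj {3F} {0F} eq = ⊥-elim (across a₁∈X b₂∈Y (sym eq))
      g-inj {3F} {1F} eq = ⊥-elim (across a₂∈X b₂∈Y (sym eq))
      g-inj {3F} {2F} eq = ⊥-elim (b₂≢b₁ eq)
      g-inj {3F} {3F} _  = refl

lemma2p3 : ∀ {n : ℕ} (k : ℕ) (M : Matroid n) (X Y : Subset n) →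
    2 ≤ k → Simple M → Binary M → ExactVerticalSep M k X Y →
    cl M X ∩ cl M Y ≡ ∅ →
    HasInducedMC4 M
lemma2p3 k M X Y 2≤k M-simple (d , φ , rk) (((X∪Y≡E , X∩Y≡∅) , _) , exact) clX∩clY≡∅ =
  let (D , D-circuit , D-meets-X , D-meets-Y)           = ∃-crossing-circuit 2≤k exact
      (F , F-circuit , F-meets-X , F-meets-Y , F-closed) = ∃-flat-circuit D-circuit D-meets-X D-meets-Y
      (g , g-inj , g∈F)                                 = crossing-quadruple F-circuit F-meets-X F-meets-Y
  in uniform 3 4 , (λ _ → refl) ,
     induced-uniform M (⊆-antisym F-closed (⊆-cl M)) (λ _ → circuit-rank F-circuit) g g-inj g∈F (s≤s (s≤s z≤n))
  where
  open Represented M φ rk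
  open Separation M-simple (λ z → x∈p∪q⁻ X Y (subst (z ∈_) (sym X∪Y≡E) ∈⊤))
                           (∩≡∅⇒Disjoint X∩Y≡∅) (∩≡∅⇒Disjoint clX∩clY≡∅)
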